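{- Let $n,k$ be positive integers with $k\le n-1$, and let \[ F_{n,k}(x)=\sum_{j=0}^{k} a_j c_j x^j,\qquad c_j=\binom{n}{j}\binom{n-j-1}{k-j}(-1)^{k-j}, \] where $a_0,\dots,a_k$ are nonzero integers each of whose prime factors is $\le k$. If there is a prime $p>k$ that exactly divides $n(n-k)$ (i.e. $p\mid n(n-k)$ and $p^2\nmid n(n-k)$), then $F_{n,k}(x)$ is irreducible over $\mathbb{Q}$ for every such choice of $a_0,\dots,a_k$.
   Context: An integer "having all of its prime factors $\le k$" is a nonzero integer (possibly $\pm 1$) with no prime divisor exceeding $k$. -}

module Defs where

open import Data.Nat as ℕ using (ℕ; zero; suc; _∸_; _≤_; _<_)
open import Data.Nat.Combinatorics using (_C_)
open import Data.Nat.Primality using (Prime)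
open import Data.Nat.Divisibility using (_∣_)
open import Data.Integer as ℤ using (ℤ; +_; -[1+_]; ∣_∣)
open import Data.Rational as ℚ using (ℚ; 0ℚ; _/_)
open import Data.List using (List; []; _∷_; map; upTo)
open import Data.Product using (_×_; ∃; ∃-syntax)
open import Data.Empty using (⊥)
open import Relation.Nullary using (¬_)
open import Relation.Binary.PropositionalEquality using (_≡_; _≢_)

-- Polynomials over ℚ are coefficient lists, lowest degree first.
Polyℚ : Set
Polyℚ = List ℚ

coeff : Polyℚ → ℕ → ℚ
coeff []       _       = 0ℚ
coeff (c ∷ cs) zero    = c
coeff (c ∷ cs) (suc i) = coeff cs i

sumTo : ℕ → (ℕ → ℚ) → ℚ
sumTo zero    f = f zero
sumTo (suc m) f = sumTo m f ℚ.+ f (suc m)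

mulCoeff : Polyℚ → Polyℚ → ℕ → ℚ
mulCoeff g h m = sumTo m (λ i → ℚ._*_ (coeff g i) (coeff h (m ∸ i)))

PositiveDegree : Polyℚ → Set
PositiveDegree p = ∃[ i ] (1 ≤ i × coeff p i ≢ 0ℚ)

IsProduct : Polyℚ → Polyℚ → Polyℚ → Set
IsProduct f g h = ∀ m → coeff f m ≡ mulCoeff g h m

-- Irreducible in ℚ[x]: not a unit or zero (i.e. degree ≥ 1, since units of
-- ℚ[x] are the nonzero constants), and not a product of two non-units
-- (i.e. of two polynomials of positive degree).
IrreducibleOverℚ : Polyℚ → Set
IrreducibleOverℚ f =
  PositiveDegree f ×
  (∀ g h → IsProduct f g h → PositiveDegree g → PositiveDegree h → ⊥)

toℚ : ℤ → ℚ
toℚ z = z / 1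

sgn : ℕ → ℤ
sgn e = -[1+ 0 ] ℤ.^ e

cCoeff : ℕ → ℕ → ℕ → ℤ
cCoeff n k j = (+ (n C j)) ℤ.* (+ ((n ∸ j ∸ 1) C (k ∸ j))) ℤ.* sgn (k ∸ j)

F : ℕ → ℕ → (ℕ → ℤ) → Polyℚ
F n k a = map (λ j → toℚ (a j ℤ.* cCoeff n k j)) (upTo (suc k))

AllPrimeFactorsLe : ℕ → ℤ → Set
AllPrimeFactorsLe k z = z ≢ + 0 × (∀ p → Prime p → p ∣ ∣ z ∣ → p ≤ k)

-- Let p > k be the prime exactly dividing n(n − k). If p ∣ n − k, then for j < k the falling
-- factorial (n−j−1)⋯(n−k) = (k−j)! C(n−j−1, k−j) contains the factor n − k, so p ∣ c_j;
-- the factors of n(n−1)⋯(n−k+1) are all prime to p, so p ∤ c_k = C(n,k); and n − k is the only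
-- factor of (n−1)⋯(n−k) divisible by p, so p² ∤ c_0 = C(n−1,k). Since every a_j is prime to p,
-- F is Eisenstein at p. If p ∣ n, the same reasoning with the factor n shows that the reversed
-- polynomial is Eisenstein at p. Either form of Eisenstein's criterion is proved through Gauss's
-- lemma: a factorisation over ℚ is rescaled to one into integer polynomials not divisible by p,
-- and comparing the first (resp. last) coefficients prime to p of the two factors forces p² to
-- divide the constant (resp. leading) coefficient.
module Submission where

open import Defs
open import Algebra.Bundles using (CommutativeMonoid)
open import Data.Empty using (⊥; ⊥-elim)
open import Data.Integer as ℤ using (ℤ; +_)
open import Data.Integer.Divisibility.Signed
  using (_∣?_; ∣m∣n⇒∣m+n; ∣m+n∣m⇒∣n; ∣m+n∣n⇒∣m; ∣⇒∣ᵤ; ∣ᵤ⇒∣; ∣m⇒∣m*n; ∣n⇒∣m*n)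
  renaming (_∣_ to _∣ℤ_)
import Data.Integer.Properties as ℤP
open import Data.Integer.Solver using (module +-*-Solver)
open import Data.List using ([]; _∷_; map; applyUpTo; upTo; length)
open import Data.Nat as ℕ using (ℕ; zero; suc; _∸_; _*_; _^_; _≤_; _<_; z≤n; s≤s)
open import Data.Nat.Combinatorics using (_C_; nCk≡nPk/k!)
open import Data.Nat.Combinatorics.Base using (_P_; _P′_)
open import Data.Nat.Combinatorics.Specification
  using (nPk≡n!/[n∸k]!; nP′k≡n!/[n∸k]!; k!∣nP′k; nP′k≡n[n∸1P′k∸1])
import Data.Nat.Coprimality as Coprimality
open import Data.Nat.Divisibility as ℕD using (_∣_; divides)
open import Data.Nat.DivMod using (m/n*n≡m)
open import Data.Nat.Primality using (Prime; euclidsLemma; prime⇒nonZero; prime⇒nonTrivial; ¬prime[1])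
import Data.Nat.Properties as ℕP
open import Data.Product using (_×_; _,_; proj₁; proj₂; ∃-syntax)
open import Data.Rational as ℚ using (ℚ; 0ℚ; ↥_; ↧_; ↧ₙ_)
import Data.Rational.Properties as ℚP
open import Data.Rational.Unnormalised as ℚᵘ using (mkℚᵘ; *≡*)
import Data.Rational.Unnormalised.Properties as ℚᵘP
open import Data.Sum as Sum using (_⊎_; inj₁; inj₂; [_,_]′)
open import Function using (_∘_)
open import Relation.Binary.Definitions using (tri<; tri≈; tri>)
open import Relation.Binary.PropositionalEquality
open import Relation.Nullary using (¬_; Dec; yes; no; ¬?)
open import Relation.Nullary.Decidable using (decidable-stable)

open import Algebra.Properties.CommutativeSemigroup
  (CommutativeMonoid.commutativeSemigroup ℚP.*-1-commutativeMonoid)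
  using () renaming (interchange to *-interchange)

toℚ≃mkℚᵘ : ∀ z → ℚ.toℚᵘ (toℚ z) ℚᵘ.≃ mkℚᵘ z 0
toℚ≃mkℚᵘ z = ℚP.toℚᵘ-fromℚᵘ (mkℚᵘ z 0)

toℚ-injective : ∀ {a b} → toℚ a ≡ toℚ b → a ≡ b
toℚ-injective {a} {b} eq
  with ℚᵘP.≃-trans (ℚᵘP.≃-sym (toℚ≃mkℚᵘ a)) (ℚᵘP.≃-trans (ℚP.toℚᵘ-cong eq) (toℚ≃mkℚᵘ b))
... | *≡* e = trans (sym (ℤP.*-identityʳ a)) (trans e (ℤP.*-identityʳ b))

module _ where
  open ℚᵘP.≃-Reasoning
  open +-*-Solver using (solve; _:+_; _:*_; _:=_; con)

  toℚ-+ : ∀ a b → toℚ (a ℤ.+ b) ≡ toℚ a ℚ.+ toℚ b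
  toℚ-+ a b = ℚP.toℚᵘ-injective (begin
    ℚ.toℚᵘ (toℚ (a ℤ.+ b))             ≈⟨ toℚ≃mkℚᵘ (a ℤ.+ b) ⟩
    mkℚᵘ (a ℤ.+ b) 0                   ≈⟨ *≡* (solve 2 (λ a b → (a :+ b) :* (con (+ 1) :* con (+ 1))
                                                      := (a :* con (+ 1) :+ b :* con (+ 1)) :* con (+ 1)) refl a b) ⟩
    mkℚᵘ a 0 ℚᵘ.+ mkℚᵘ b 0             ≈⟨ ℚᵘP.+-cong (ℚᵘP.≃-sym (toℚ≃mkℚᵘ a)) (ℚᵘP.≃-sym (toℚ≃mkℚᵘ b)) ⟩
    ℚ.toℚᵘ (toℚ a) ℚᵘ.+ ℚ.toℚᵘ (toℚ b) ≈⟨ ℚᵘP.≃-sym (ℚP.toℚᵘ-homo-+ (toℚ a) (toℚ b)) ⟩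
    ℚ.toℚᵘ (toℚ a ℚ.+ toℚ b)           ∎)

  toℚ-* : ∀ a b → toℚ (a ℤ.* b) ≡ toℚ a ℚ.* toℚ b
  toℚ-* a b = ℚP.toℚᵘ-injective (begin
    ℚ.toℚᵘ (toℚ (a ℤ.* b))             ≈⟨ toℚ≃mkℚᵘ (a ℤ.* b) ⟩
    mkℚᵘ (a ℤ.* b) 0                   ≈⟨ *≡* (solve 2 (λ a b → (a :* b) :* (con (+ 1) :* con (+ 1))
                                                      := (a :* b) :* con (+ 1)) refl a b) ⟩
    mkℚᵘ a 0 ℚᵘ.* mkℚᵘ b 0             ≈⟨ ℚᵘP.*-cong (ℚᵘP.≃-sym (toℚ≃mkℚᵘ a)) (ℚᵘP.≃-sym (toℚ≃mkℚᵘ b)) ⟩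
    ℚ.toℚᵘ (toℚ a) ℚᵘ.* ℚ.toℚᵘ (toℚ b) ≈⟨ ℚᵘP.≃-sym (ℚP.toℚᵘ-homo-* (toℚ a) (toℚ b)) ⟩
    ℚ.toℚᵘ (toℚ a ℚ.* toℚ b)           ∎)

  *-↧≡↥ : ∀ q → q ℚ.* toℚ (↧ q) ≡ toℚ (↥ q)
  *-↧≡↥ q@(ℚ.mkℚ n d _) = ℚP.toℚᵘ-injective (begin
    ℚ.toℚᵘ (q ℚ.* toℚ (↧ q))          ≈⟨ ℚP.toℚᵘ-homo-* q (toℚ (↧ q)) ⟩
    mkℚᵘ n d ℚᵘ.* ℚ.toℚᵘ (toℚ (↧ q))  ≈⟨ ℚᵘP.*-congˡ {mkℚᵘ n d} (toℚ≃mkℚᵘ (↧ q)) ⟩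
    mkℚᵘ n d ℚᵘ.* mkℚᵘ (↧ q) 0        ≈⟨ *≡* (solve 2 (λ n e → (n :* e) :* con (+ 1) := n :* (e :* con (+ 1)))
                                                      refl n (↧ q)) ⟩
    mkℚᵘ n 0                          ≈⟨ ℚᵘP.≃-sym (toℚ≃mkℚᵘ n) ⟩
    ℚ.toℚᵘ (toℚ n)                    ∎)

toℚ-pos-* : ∀ m n → toℚ (+ (m * n)) ≡ toℚ (+ m) ℚ.* toℚ (+ n)
toℚ-pos-* m n = trans (cong toℚ (ℤP.pos-* m n)) (toℚ-* (+ m) (+ n))

sumℤTo : ℕ → (ℕ → ℤ) → ℤ
sumℤTo zero    t = t zero
sumℤTo (suc m) t = sumℤTo m t ℤ.+ t (suc m)

toℚ-sumℤTo : ∀ m t → toℚ (sumℤTo m t) ≡ sumTo m (toℚ ∘ t)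
toℚ-sumℤTo zero    t = refl
toℚ-sumℤTo (suc m) t = trans (toℚ-+ (sumℤTo m t) (t (suc m))) (cong (ℚ._+ toℚ (t (suc m))) (toℚ-sumℤTo m t))

sumTo-cong : ∀ m {s t : ℕ → ℚ} → (∀ i → s i ≡ t i) → sumTo m s ≡ sumTo m t
sumTo-cong zero    s≡t = s≡t 0
sumTo-cong (suc m) s≡t = cong₂ ℚ._+_ (sumTo-cong m s≡t) (s≡t (suc m))

*-distribˡ-sumTo : ∀ m c (t : ℕ → ℚ) → c ℚ.* sumTo m t ≡ sumTo m (λ i → c ℚ.* t i)
*-distribˡ-sumTo zero    c t = refl
*-distribˡ-sumTo (suc m) c t =
  trans (ℚP.*-distribˡ-+ c (sumTo m t) (t (suc m))) (cong (ℚ._+ (c ℚ.* t (suc m))) (*-distribˡ-sumTo m c t))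

sumℤTo-≡0 : ∀ m t → (∀ i → i ≤ m → t i ≡ + 0) → sumℤTo m t ≡ + 0
sumℤTo-≡0 zero    t t≡0 = t≡0 0 z≤n
sumℤTo-≡0 (suc m) t t≡0 = cong₂ ℤ._+_ (sumℤTo-≡0 m t (λ i → t≡0 i ∘ ℕP.m≤n⇒m≤1+n)) (t≡0 (suc m) ℕP.≤-refl)

sumℤTo-single : ∀ m t {j} → j ≤ m → (∀ i → i ≤ m → i ≢ j → t i ≡ + 0) → sumℤTo m t ≡ t j
sumℤTo-single zero    t z≤n _ = refl
sumℤTo-single (suc m) t j≤1+m others with ℕP.m≤n⇒m<n∨m≡n j≤1+m
... | inj₂ refl =
  trans (cong (ℤ._+ t (suc m)) (sumℤTo-≡0 m t λ i i≤m → others i (ℕP.m≤n⇒m≤1+n i≤m) (ℕP.<⇒≢ (s≤s i≤m))))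
        (ℤP.+-identityˡ (t (suc m)))
... | inj₁ (s≤s j≤m) =
  trans (cong₂ ℤ._+_ (sumℤTo-single m t j≤m λ i i≤m → others i (ℕP.m≤n⇒m≤1+n i≤m))
                     (others (suc m) ℕP.≤-refl (ℕP.<⇒≢ (s≤s j≤m) ∘ sym)))
        (ℤP.+-identityʳ _)

∣-sumℤTo : ∀ {d} m t → (∀ i → i ≤ m → d ∣ℤ t i) → d ∣ℤ sumℤTo m t
∣-sumℤTo zero    t d∣t = d∣t 0 z≤n
∣-sumℤTo (suc m) t d∣t = ∣m∣n⇒∣m+n (∣-sumℤTo m t (λ i → d∣t i ∘ ℕP.m≤n⇒m≤1+n)) (d∣t (suc m) ℕP.≤-refl)

∤-sumℤTo-single : ∀ {d} m t {j} → j ≤ m → ¬ d ∣ℤ t j → (∀ i → i ≤ m → i ≢ j → d ∣ℤ t i) → ¬ d ∣ℤ sumℤTo m t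
∤-sumℤTo-single zero    t z≤n d∤tj _ = d∤tj
∤-sumℤTo-single (suc m) t j≤1+m d∤tj others d∣sum with ℕP.m≤n⇒m<n∨m≡n j≤1+m
... | inj₂ refl =
  d∤tj (∣m+n∣m⇒∣n d∣sum (∣-sumℤTo m t λ i i≤m → others i (ℕP.m≤n⇒m≤1+n i≤m) (ℕP.<⇒≢ (s≤s i≤m))))
... | inj₁ (s≤s j≤m) =
  ∤-sumℤTo-single m t j≤m d∤tj (λ i i≤m → others i (ℕP.m≤n⇒m≤1+n i≤m))
    (∣m+n∣n⇒∣m d∣sum (others (suc m) ℕP.≤-refl (ℕP.<⇒≢ (s≤s j≤m) ∘ sym)))

conv : (ℕ → ℤ) → (ℕ → ℤ) → ℕ → ℤ
conv W Y m = sumℤTo m (λ i → W i ℤ.* Y (m ∸ i))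

record HasDegree (W : ℕ → ℤ) (d : ℕ) : Set where
  field
    leading≢0 : W d ≢ + 0
    vanishes  : ∀ i → d < i → W i ≡ + 0

<⇒<+∸ : ∀ {r s i} → i < r → s < r ℕ.+ s ∸ i
<⇒<+∸ {r} {s} {i} i<r = subst (_< r ℕ.+ s ∸ i) (ℕP.m+n∸m≡n r s) (ℕP.∸-monoʳ-< i<r (ℕP.m≤m+n r s))

>⇒+∸< : ∀ {r s i} → r < i → i ≤ r ℕ.+ s → r ℕ.+ s ∸ i < s
>⇒+∸< {r} {s} {i} r<i i≤r+s = subst (r ℕ.+ s ∸ i <_) (ℕP.m+n∸m≡n r s) (ℕP.∸-monoʳ-< r<i i≤r+s)

module _ {W Y : ℕ → ℤ} {dg dh : ℕ} (degW : HasDegree W dg) (degY : HasDegree Y dh) where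
  open HasDegree

  private
    term≡0 : ∀ m i → dg < i ⊎ dh < m ∸ i → W i ℤ.* Y (m ∸ i) ≡ + 0
    term≡0 m i (inj₁ dg<i)   = trans (cong (ℤ._* Y (m ∸ i)) (vanishes degW i dg<i)) (ℤP.*-zeroˡ (Y (m ∸ i)))
    term≡0 m i (inj₂ dh<m∸i) = trans (cong (W i ℤ.*_) (vanishes degY (m ∸ i) dh<m∸i)) (ℤP.*-zeroʳ (W i))

  conv-leading : conv W Y (dg ℕ.+ dh) ≡ W dg ℤ.* Y dh
  conv-leading = trans (sumℤTo-single (dg ℕ.+ dh) _ (ℕP.m≤m+n dg dh) others)
                       (cong (λ j → W dg ℤ.* Y j) (ℕP.m+n∸m≡n dg dh))
    where
    others : ∀ i → i ≤ dg ℕ.+ dh → i ≢ dg → W i ℤ.* Y (dg ℕ.+ dh ∸ i) ≡ + 0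
    others i _ i≢dg with ℕP.<-cmp i dg
    ... | tri< i<dg _ _ = term≡0 _ i (inj₂ (<⇒<+∸ i<dg))
    ... | tri≈ _ i≡dg _ = ⊥-elim (i≢dg i≡dg)
    ... | tri> _ _ dg<i = term≡0 _ i (inj₁ dg<i)

  conv-degree : HasDegree (conv W Y) (dg ℕ.+ dh)
  conv-degree = record
    { leading≢0 = λ eq → [ leading≢0 degW , leading≢0 degY ]′
                             (ℤP.i*j≡0⇒i≡0∨j≡0 (W dg) (trans (sym conv-leading) eq))
    ; vanishes  = λ m d<m → sumℤTo-≡0 m _ λ i _ → term≡0 m i (beyond d<m i)
    }
    where
    beyond : ∀ {m} → dg ℕ.+ dh < m → ∀ i → dg < i ⊎ dh < m ∸ i
    beyond {m} d<m i with dg ℕ.<? i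
    ... | yes dg<i = inj₁ dg<i
    ... | no  dg≮i = inj₂ (ℕP.<-≤-trans
      (ℕP.m+n≤o⇒m≤o∸n (suc dh) (subst (_≤ m) (cong suc (ℕP.+-comm dg dh)) d<m))
      (ℕP.∸-monoʳ-≤ m (ℕP.≮⇒≥ dg≮i)))

*-degree : ∀ {c Z W d} → c ≢ + 0 → (∀ i → Z i ≡ c ℤ.* W i) → HasDegree Z d → HasDegree W d
*-degree {c} {Z} {W} {d} c≢0 Z≡cW degZ = record
  { leading≢0 = λ Wd≡0 → HasDegree.leading≢0 degZ (trans (Z≡cW d) (trans (cong (c ℤ.*_) Wd≡0) (ℤP.*-zeroʳ c)))
  ; vanishes  = λ i d<i → W≡0 (trans (sym (Z≡cW i)) (HasDegree.vanishes degZ i d<i))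
  }
  where
  W≡0 : ∀ {i} → c ℤ.* W i ≡ + 0 → W i ≡ + 0
  W≡0 cWi≡0 = [ ⊥-elim ∘ c≢0 , (λ Wi≡0 → Wi≡0) ]′ (ℤP.i*j≡0⇒i≡0∨j≡0 c cWi≡0)

least : ∀ {Q : ℕ → Set} → (∀ i → Dec (Q i)) → ∀ {n} → Q n → ∃[ r ] (Q r × (∀ j → j < r → ¬ Q j))
least         Q? {zero}  Q0  = 0 , Q0 , λ _ ()
least {Q = Q} Q? {suc n} Qsn with Q? 0 | least {Q = Q ∘ suc} (Q? ∘ suc) Qsn
... | yes Q0  | _               = 0 , Q0 , λ _ ()
... | no  ¬Q0 | r , Qr , before = suc r , Qr , λ where
  zero    _         → ¬Q0
  (suc j) (s≤s j<r) → before j j<r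

greatest : ∀ {Q : ℕ → Set} → (∀ i → Dec (Q i)) → ∀ B → (∀ j → B < j → ¬ Q j) →
           ∀ {n} → Q n → ∃[ R ] (Q R × (∀ j → R < j → ¬ Q j))
greatest Q? B after Qn with Q? B
... | yes QB = B , QB , after
greatest Q? zero    after {zero}  Q0  | no ¬Q0 = ⊥-elim (¬Q0 Q0)
greatest Q? zero    after {suc n} Qsn | no _   = ⊥-elim (after (suc n) (s≤s z≤n) Qsn)
greatest Q? (suc B) after         Qn  | no ¬QB = greatest Q? B after′ Qn
  where
  after′ : ∀ j → B < j → ¬ _
  after′ j B<j with ℕP.m≤n⇒m<n∨m≡n B<j
  ... | inj₁ 1+B<j = after j 1+B<j
  ... | inj₂ refl  = ¬QB

coeff-map-applyUpTo : ∀ (h : ℕ → ℚ) f n m → m < n → coeff (map h (applyUpTo f n)) m ≡ h (f m)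
coeff-map-applyUpTo h f (suc n) zero    _         = refl
coeff-map-applyUpTo h f (suc n) (suc m) (s≤s m<n) = coeff-map-applyUpTo h (f ∘ suc) n m m<n

coeff-map-applyUpTo-≥ : ∀ (h : ℕ → ℚ) f n m → n ≤ m → coeff (map h (applyUpTo f n)) m ≡ 0ℚ
coeff-map-applyUpTo-≥ h f zero    m       _         = refl
coeff-map-applyUpTo-≥ h f (suc n) (suc m) (s≤s n≤m) = coeff-map-applyUpTo-≥ h (f ∘ suc) n m n≤m

coeff-≥length : ∀ g i → length g ≤ i → coeff g i ≡ 0ℚ
coeff-≥length []       i       _            = refl
coeff-≥length (c ∷ cs) (suc i) (s≤s |cs|≤i) = coeff-≥length cs i |cs|≤i

record RationalDegree (g : Polyℚ) : Set where
  field
    degree    : ℕ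
    0<degree  : 0 < degree
    leading≢0 : coeff g degree ≢ 0ℚ
    vanishes  : ∀ i → degree < i → coeff g i ≡ 0ℚ

rational-degree : ∀ {g} → PositiveDegree g → RationalDegree g
rational-degree {g} (i , 1≤i , gi≢0)
  with greatest (λ j → ¬? (coeff g j ℚP.≟ 0ℚ)) (length g)
                (λ j |g|<j gj≢0 → gj≢0 (coeff-≥length g j (ℕP.<⇒≤ |g|<j))) gi≢0
... | d , gd≢0 , after = record
  { degree    = d
  ; 0<degree  = ℕP.≤-trans 1≤i (ℕP.≮⇒≥ λ d<i → after i d<i gi≢0)
  ; leading≢0 = gd≢0
  ; vanishes  = λ j d<j → decidable-stable (coeff g j ℚP.≟ 0ℚ) (after j d<j)
  }

denominatorProduct : Polyℚ → ℕ
denominatorProduct []       = 1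
denominatorProduct (c ∷ cs) = ↧ₙ c * denominatorProduct cs

denominatorProduct≢0 : ∀ g → ℕ.NonZero (denominatorProduct g)
denominatorProduct≢0 []       = _
denominatorProduct≢0 (c ∷ cs) = ℕP.m*n≢0 (↧ₙ c) (denominatorProduct cs) {{_}} {{denominatorProduct≢0 cs}}

clearDenominators : Polyℚ → ℕ → ℤ
clearDenominators []       _       = + 0
clearDenominators (c ∷ cs) zero    = ↥ c ℤ.* + denominatorProduct cs
clearDenominators (c ∷ cs) (suc i) = ↧ c ℤ.* clearDenominators cs i

clearDenominators-coeff : ∀ g i → toℚ (+ denominatorProduct g) ℚ.* coeff g i ≡ toℚ (clearDenominators g i)
clearDenominators-coeff []       i       = ℚP.*-zeroʳ (toℚ (+ 1))
clearDenominators-coeff (c ∷ cs) zero    = begin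
  toℚ (+ (↧ₙ c * D)) ℚ.* c         ≡⟨ cong (ℚ._* c) (toℚ-pos-* (↧ₙ c) D) ⟩
  toℚ (↧ c) ℚ.* toℚ (+ D) ℚ.* c    ≡⟨ ℚP.*-comm (toℚ (↧ c) ℚ.* toℚ (+ D)) c ⟩
  c ℚ.* (toℚ (↧ c) ℚ.* toℚ (+ D))  ≡⟨ ℚP.*-assoc c (toℚ (↧ c)) (toℚ (+ D)) ⟨
  c ℚ.* toℚ (↧ c) ℚ.* toℚ (+ D)    ≡⟨ cong (ℚ._* toℚ (+ D)) (*-↧≡↥ c) ⟩
  toℚ (↥ c) ℚ.* toℚ (+ D)          ≡⟨ toℚ-* (↥ c) (+ D) ⟨
  toℚ (↥ c ℤ.* + D)                ∎
  where
  open ≡-Reasoning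
  D = denominatorProduct cs
clearDenominators-coeff (c ∷ cs) (suc i) = begin
  toℚ (+ (↧ₙ c * D)) ℚ.* coeff cs i           ≡⟨ cong (ℚ._* coeff cs i) (toℚ-pos-* (↧ₙ c) D) ⟩
  toℚ (↧ c) ℚ.* toℚ (+ D) ℚ.* coeff cs i      ≡⟨ ℚP.*-assoc (toℚ (↧ c)) (toℚ (+ D)) (coeff cs i) ⟩
  toℚ (↧ c) ℚ.* (toℚ (+ D) ℚ.* coeff cs i)    ≡⟨ cong (toℚ (↧ c) ℚ.*_) (clearDenominators-coeff cs i) ⟩
  toℚ (↧ c) ℚ.* toℚ (clearDenominators cs i)  ≡⟨ toℚ-* (↧ c) (clearDenominators cs i) ⟨
  toℚ (↧ c ℤ.* clearDenominators cs i)        ∎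
  where
  open ≡-Reasoning
  D = denominatorProduct cs

scaled-product : ∀ f g h {cg ch W Y} → IsProduct f g h →
                 (∀ i → coeff g i ≡ cg ℚ.* toℚ (W i)) → (∀ i → coeff h i ≡ ch ℚ.* toℚ (Y i)) →
                 ∀ m → coeff f m ≡ (cg ℚ.* ch) ℚ.* toℚ (conv W Y m)
scaled-product f g h {cg} {ch} {W} {Y} f≡gh g≡cgW h≡chY m = begin
  coeff f m                                                ≡⟨ f≡gh m ⟩
  sumTo m (λ i → coeff g i ℚ.* coeff h (m ∸ i))            ≡⟨ sumTo-cong m term ⟩
  sumTo m (λ i → (cg ℚ.* ch) ℚ.* toℚ (W i ℤ.* Y (m ∸ i)))  ≡⟨ *-distribˡ-sumTo m (cg ℚ.* ch) _ ⟨
  (cg ℚ.* ch) ℚ.* sumTo m (λ i → toℚ (W i ℤ.* Y (m ∸ i)))  ≡⟨ cong ((cg ℚ.* ch) ℚ.*_) (toℚ-sumℤTo m _) ⟨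
  (cg ℚ.* ch) ℚ.* toℚ (conv W Y m)                         ∎
  where
  open ≡-Reasoning
  term : ∀ i → coeff g i ℚ.* coeff h (m ∸ i) ≡ (cg ℚ.* ch) ℚ.* toℚ (W i ℤ.* Y (m ∸ i))
  term i = begin
    coeff g i ℚ.* coeff h (m ∸ i)                    ≡⟨ cong₂ ℚ._*_ (g≡cgW i) (h≡chY (m ∸ i)) ⟩
    (cg ℚ.* toℚ (W i)) ℚ.* (ch ℚ.* toℚ (Y (m ∸ i)))  ≡⟨ *-interchange cg (toℚ (W i)) ch (toℚ (Y (m ∸ i))) ⟩
    (cg ℚ.* ch) ℚ.* (toℚ (W i) ℚ.* toℚ (Y (m ∸ i)))  ≡⟨ cong ((cg ℚ.* ch) ℚ.*_) (toℚ-* (W i) (Y (m ∸ i))) ⟨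
    (cg ℚ.* ch) ℚ.* toℚ (W i ℤ.* Y (m ∸ i))          ∎

polynomial : ℕ → (ℕ → ℤ) → Polyℚ
polynomial k A = map (λ j → toℚ (A j)) (upTo (suc k))

truncate : ℕ → (ℕ → ℤ) → ℕ → ℤ
truncate k A m with m ℕ.≤? k
... | yes _ = A m
... | no  _ = + 0

truncate-≤ : ∀ {k A m} → m ≤ k → truncate k A m ≡ A m
truncate-≤ {k} {A} {m} m≤k with m ℕ.≤? k
... | yes _   = refl
... | no  m≰k = ⊥-elim (m≰k m≤k)

truncate-> : ∀ {k A m} → k < m → truncate k A m ≡ + 0
truncate-> {k} {A} {m} k<m with m ℕ.≤? k
... | yes m≤k = ⊥-elim (ℕP.<⇒≱ k<m m≤k)
... | no  _   = refl

coeff-polynomial : ∀ k A m → coeff (polynomial k A) m ≡ toℚ (truncate k A m)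
coeff-polynomial k A m with m ℕ.≤? k
... | yes m≤k = coeff-map-applyUpTo (toℚ ∘ A) (λ j → j) (suc k) m (s≤s m≤k)
... | no  m≰k = coeff-map-applyUpTo-≥ (toℚ ∘ A) (λ j → j) (suc k) m (ℕP.≰⇒> m≰k)

-- Divisibility by a prime

∣+0 : ∀ d → d ∣ℤ + 0
∣+0 d = ∣ᵤ⇒∣ (ℤ.∣ d ∣ ℕD.∣0)

∤⇒≢0 : ∀ {d i} → ¬ d ∣ℤ i → i ≢ + 0
∤⇒≢0 {d} d∤i refl = d∤i (∣+0 d)

module _ {p : ℕ} (p-prime : Prime p) where

  private instance
    p≢0 : ℕ.NonZero p
    p≢0 = prime⇒nonZero p-prime

  p²∣m*n∧p∤n⇒p²∣m : ∀ {m n} → ¬ p ∣ n → p * p ∣ m * n → p * p ∣ m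
  p²∣m*n∧p∤n⇒p²∣m {m} {n} p∤n p²∣mn with euclidsLemma m n p-prime (ℕD.∣-trans (ℕD.m∣m*n p) p²∣mn)
  ... | inj₂ p∣n = ⊥-elim (p∤n p∣n)
  ... | inj₁ (divides q refl) with euclidsLemma q n p-prime (ℕD.*-cancelʳ-∣ p (subst (p * p ∣_) qpn≡qnp p²∣mn))
    where qpn≡qnp = trans (ℕP.*-assoc q p n) (trans (cong (q *_) (ℕP.*-comm p n)) (sym (ℕP.*-assoc q n p)))
  ...   | inj₁ p∣q = ℕD.*-monoˡ-∣ p p∣q
  ...   | inj₂ p∣n = ⊥-elim (p∤n p∣n)

  p∣i*j⇒p∣i∨p∣j : ∀ i j → + p ∣ℤ i ℤ.* j → + p ∣ℤ i ⊎ + p ∣ℤ j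
  p∣i*j⇒p∣i∨p∣j i j p∣ij =
    Sum.map ∣ᵤ⇒∣ ∣ᵤ⇒∣ (euclidsLemma ℤ.∣ i ∣ ℤ.∣ j ∣ p-prime (subst (p ∣_) (ℤP.abs-* i j) (∣⇒∣ᵤ p∣ij)))

  p∤i∧p∤j⇒p∤i*j : ∀ {i j} → ¬ + p ∣ℤ i → ¬ + p ∣ℤ j → ¬ + p ∣ℤ i ℤ.* j
  p∤i∧p∤j⇒p∤i*j {i} {j} p∤i p∤j = [ p∤i , p∤j ]′ ∘ p∣i*j⇒p∣i∨p∣j i j

  p∣i∧p∣j⇒p²∣i*j : ∀ {i j} → + p ∣ℤ i → + p ∣ℤ j → + (p * p) ∣ℤ i ℤ.* j
  p∣i∧p∣j⇒p²∣i*j {i} {j} p∣i p∣j =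
    ∣ᵤ⇒∣ (subst (p * p ∣_) (sym (ℤP.abs-* i j)) (ℕD.*-pres-∣ (∣⇒∣ᵤ p∣i) (∣⇒∣ᵤ p∣j)))

  p²∣i*j∧p∤j⇒p²∣i : ∀ {i j} → ¬ + p ∣ℤ j → + (p * p) ∣ℤ i ℤ.* j → + (p * p) ∣ℤ i
  p²∣i*j∧p∤j⇒p²∣i {i} {j} p∤j p²∣ij =
    ∣ᵤ⇒∣ (p²∣m*n∧p∤n⇒p²∣m (p∤j ∘ ∣ᵤ⇒∣) (subst (p * p ∣_) (ℤP.abs-* i j) (∣⇒∣ᵤ p²∣ij)))

  p∣-stable : ∀ {i} → ¬ ¬ + p ∣ℤ i → + p ∣ℤ i
  p∣-stable {i} = decidable-stable (+ p ∣? i)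

  +p≢0 : + p ≢ + 0
  +p≢0 = ℕ.≢-nonZero⁻¹ p ∘ ℤP.+-injective

  +p^e≢0 : ∀ e → + (p ^ e) ≢ + 0
  +p^e≢0 e = ℕ.≢-nonZero⁻¹ (p ^ e) {{ℕP.m^n≢0 p e}} ∘ ℤP.+-injective

  -- Eisenstein's criterion and its reversal

  Primitive : (ℕ → ℤ) → Set
  Primitive W = ∃[ i ] ¬ + p ∣ℤ W i

  p∣beyond-degree : ∀ {W d i} → HasDegree W d → d < i → + p ∣ℤ W i
  p∣beyond-degree degW d<i = subst (+ p ∣ℤ_) (sym (HasDegree.vanishes degW _ d<i)) (∣+0 (+ p))

  first-unit : ∀ {W} → Primitive W → ∃[ r ] (¬ + p ∣ℤ W r × (∀ i → i < r → + p ∣ℤ W i))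
  first-unit {W} (_ , p∤Wi) with least (λ j → ¬? (+ p ∣? W j)) p∤Wi
  ... | r , p∤Wr , before = r , p∤Wr , λ i i<r → p∣-stable (before i i<r)

  last-unit : ∀ {W d} → HasDegree W d → Primitive W → ∃[ R ] (¬ + p ∣ℤ W R × (∀ i → R < i → + p ∣ℤ W i))
  last-unit {W} {d} degW (_ , p∤Wi)
    with greatest (λ j → ¬? (+ p ∣? W j)) d (λ j d<j p∤Wj → p∤Wj (p∣beyond-degree degW d<j)) p∤Wi
  ... | R , p∤WR , after = R , p∤WR , λ i R<i → p∣-stable (after i R<i)

  module _ {W Y : ℕ → ℤ} {r s : ℕ} (p∤Wr : ¬ + p ∣ℤ W r) (p∤Ys : ¬ + p ∣ℤ Y s) where

    private
      p∤conv : (∀ i → i ≤ r ℕ.+ s → i ≢ r → + p ∣ℤ W i ℤ.* Y (r ℕ.+ s ∸ i)) → ¬ + p ∣ℤ conv W Y (r ℕ.+ s)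
      p∤conv = ∤-sumℤTo-single (r ℕ.+ s) _ (ℕP.m≤m+n r s)
        (subst (λ j → ¬ + p ∣ℤ W r ℤ.* Y j) (sym (ℕP.m+n∸m≡n r s)) (p∤i∧p∤j⇒p∤i*j p∤Wr p∤Ys))

    p∤conv-first : (∀ i → i < r → + p ∣ℤ W i) → (∀ j → j < s → + p ∣ℤ Y j) → ¬ + p ∣ℤ conv W Y (r ℕ.+ s)
    p∤conv-first W<r Y<s = p∤conv others
      where
      others : ∀ i → i ≤ r ℕ.+ s → i ≢ r → + p ∣ℤ W i ℤ.* Y (r ℕ.+ s ∸ i)
      others i i≤r+s i≢r with ℕP.<-cmp i r
      ... | tri< i<r _ _ = ∣m⇒∣m*n _ (W<r i i<r)
      ... | tri≈ _ i≡r _ = ⊥-elim (i≢r i≡r)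
      ... | tri> _ _ r<i = ∣n⇒∣m*n (W i) (Y<s _ (>⇒+∸< r<i i≤r+s))

    p∤conv-last : (∀ i → r < i → + p ∣ℤ W i) → (∀ j → s < j → + p ∣ℤ Y j) → ¬ + p ∣ℤ conv W Y (r ℕ.+ s)
    p∤conv-last W>r Y>s = p∤conv others
      where
      others : ∀ i → i ≤ r ℕ.+ s → i ≢ r → + p ∣ℤ W i ℤ.* Y (r ℕ.+ s ∸ i)
      others i _ i≢r with ℕP.<-cmp i r
      ... | tri< i<r _ _ = ∣n⇒∣m*n (W i) (Y>s _ (<⇒<+∸ i<r))
      ... | tri≈ _ i≡r _ = ⊥-elim (i≢r i≡r)
      ... | tri> _ _ r<i = ∣m⇒∣m*n _ (W>r i r<i)

  conv-primitive : ∀ {W Y} → Primitive W → Primitive Y → Primitive (conv W Y)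
  conv-primitive primW primY with first-unit primW | first-unit primY
  ... | r , p∤Wr , W<r | s , p∤Ys , Y<s = r ℕ.+ s , p∤conv-first p∤Wr p∤Ys W<r Y<s

  record Associated (F G : ℕ → ℤ) : Set where
    field
      u v     : ℤ
      p∤u     : ¬ + p ∣ℤ u
      p∤v     : ¬ + p ∣ℤ v
      u*F≡v*G : ∀ m → u ℤ.* F m ≡ v ℤ.* G m

  module _ {F G : ℕ → ℤ} (F∼G : Associated F G) where
    open Associated F∼G

    associated-sym : Associated G F
    associated-sym = record { p∤u = p∤v ; p∤v = p∤u ; u*F≡v*G = sym ∘ u*F≡v*G }

    associated-∣ : ∀ {m} → + p ∣ℤ F m → + p ∣ℤ G m
    associated-∣ {m} p∣Fm with p∣i*j⇒p∣i∨p∣j v (G m) (subst (+ p ∣ℤ_) (u*F≡v*G m) (∣n⇒∣m*n u p∣Fm))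
    ... | inj₁ p∣v  = ⊥-elim (p∤v p∣v)
    ... | inj₂ p∣Gm = p∣Gm

    associated-p²∣ : ∀ {m} → + (p * p) ∣ℤ G m → + (p * p) ∣ℤ F m
    associated-p²∣ {m} p²∣Gm = p²∣i*j∧p∤j⇒p²∣i p∤u
      (subst (+ (p * p) ∣ℤ_) (trans (sym (u*F≡v*G m)) (ℤP.*-comm u (F m))) (∣n⇒∣m*n v p²∣Gm))

    associated-≡0 : ∀ {m} → F m ≡ + 0 → G m ≡ + 0
    associated-≡0 {m} Fm≡0
      with ℤP.i*j≡0⇒i≡0∨j≡0 v (trans (sym (u*F≡v*G m)) (trans (cong (u ℤ.*_) Fm≡0) (ℤP.*-zeroʳ u)))
    ... | inj₁ v≡0  = ⊥-elim (∤⇒≢0 p∤v v≡0)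
    ... | inj₂ Gm≡0 = Gm≡0

  associated-degree : ∀ {F G k d} → Associated F G → HasDegree F k → HasDegree G d → k ≡ d
  associated-degree F∼G degF degG with ℕP.<-cmp _ _
  ... | tri< k<d _ _ = ⊥-elim (HasDegree.leading≢0 degG (associated-≡0 F∼G (HasDegree.vanishes degF _ k<d)))
  ... | tri≈ _ k≡d _ = k≡d
  ... | tri> _ _ d<k =
    ⊥-elim (HasDegree.leading≢0 degF (associated-≡0 (associated-sym F∼G) (HasDegree.vanishes degG _ d<k)))

  -- Writing c = ↥ c / ↧ c in lowest terms, a coefficient of F and a coefficient of G prime to p
  -- show that neither ↧ c nor ↥ c is divisible by p.
  associated : ∀ {F G} (c : ℚ) → (∀ m → toℚ (F m) ≡ c ℚ.* toℚ (G m)) → Primitive F → Primitive G → Associated F G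
  associated {F} {G} c@(ℚ.mkℚ _ _ isCoprime) F≡cG (m₀ , p∤Fm₀) (m₁ , p∤Gm₁) = record
    { u       = ↧ c
    ; v       = ↥ c
    ; p∤u     = λ p∣u → coprime (transfer (scaled m₁) p∤Gm₁ p∣u) p∣u
    ; p∤v     = λ p∣v → coprime p∣v (transfer (sym (scaled m₀)) p∤Fm₀ p∣v)
    ; u*F≡v*G = scaled
    }
    where
    open ≡-Reasoning

    scaled : ∀ m → ↧ c ℤ.* F m ≡ ↥ c ℤ.* G m
    scaled m = toℚ-injective (begin
      toℚ (↧ c ℤ.* F m)                ≡⟨ toℚ-* (↧ c) (F m) ⟩
      toℚ (↧ c) ℚ.* toℚ (F m)          ≡⟨ cong (toℚ (↧ c) ℚ.*_) (F≡cG m) ⟩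
      toℚ (↧ c) ℚ.* (c ℚ.* toℚ (G m))  ≡⟨ ℚP.*-assoc (toℚ (↧ c)) c (toℚ (G m)) ⟨
      toℚ (↧ c) ℚ.* c ℚ.* toℚ (G m)    ≡⟨ cong (ℚ._* toℚ (G m)) (trans (ℚP.*-comm (toℚ (↧ c)) c) (*-↧≡↥ c)) ⟩
      toℚ (↥ c) ℚ.* toℚ (G m)          ≡⟨ toℚ-* (↥ c) (G m) ⟨
      toℚ (↥ c ℤ.* G m)                ∎)

    transfer : ∀ {a b x y} → a ℤ.* x ≡ b ℤ.* y → ¬ + p ∣ℤ y → + p ∣ℤ a → + p ∣ℤ b
    transfer {x = x} {y} eq p∤y p∣a =
      [ (λ p∣b → p∣b) , ⊥-elim ∘ p∤y ]′ (p∣i*j⇒p∣i∨p∣j _ y (subst (+ p ∣ℤ_) eq (∣m⇒∣m*n x p∣a)))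

    coprime : + p ∣ℤ ↥ c → + p ∣ℤ ↧ c → ⊥
    coprime p∣↥c p∣↧c = ¬prime[1] (subst Prime (Coprimality.recompute isCoprime (∣⇒∣ᵤ p∣↥c , ∣⇒∣ᵤ p∣↧c)) p-prime)

  Eisenstein : ℕ → (ℕ → ℤ) → Set
  Eisenstein k A = ¬ + p ∣ℤ A k × (∀ j → j < k → + p ∣ℤ A j) × ¬ + (p * p) ∣ℤ A 0

  ReverseEisenstein : ℕ → (ℕ → ℤ) → Set
  ReverseEisenstein k A = ¬ + p ∣ℤ A 0 × (∀ j → 0 < j → j ≤ k → + p ∣ℤ A j) × ¬ + (p * p) ∣ℤ A k

  module NonFactorisation {F W Y : ℕ → ℤ} {k dg dh : ℕ}
           (F∼WY : Associated F (conv W Y)) (degF : HasDegree F k)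
           (degW : HasDegree W dg) (degY : HasDegree Y dh) (0<dg : 0 < dg) (0<dh : 0 < dh)
           (primW : Primitive W) (primY : Primitive Y) where

    private
      k≡dg+dh : k ≡ dg ℕ.+ dh
      k≡dg+dh = associated-degree F∼WY degF (conv-degree degW degY)

    -- With r, s the first indices where W, Y are prime to p, p ∤ F (r + s) forces r + s ≥ dg + dh,
    -- so r and s are positive and p divides W 0 and Y 0.
    ¬eisenstein : ¬ Eisenstein k F
    ¬eisenstein (_ , p∣F<k , p²∤F0) with first-unit primW | first-unit primY
    ... | r , p∤Wr , W<r | s , p∤Ys , Y<s = p²∤F0 (associated-p²∣ F∼WY (p∣i∧p∣j⇒p²∣i*j (W<r 0 0<r) (Y<s 0 0<s)))
      where
      k≤r+s : k ≤ r ℕ.+ s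
      k≤r+s = ℕP.≮⇒≥ λ r+s<k → p∤conv-first p∤Wr p∤Ys W<r Y<s (associated-∣ F∼WY (p∣F<k _ r+s<k))
      r≤dg : r ≤ dg
      r≤dg = ℕP.≮⇒≥ λ dg<r → p∤Wr (p∣beyond-degree degW dg<r)
      s≤dh : s ≤ dh
      s≤dh = ℕP.≮⇒≥ λ dh<s → p∤Ys (p∣beyond-degree degY dh<s)
      0<r : 0 < r
      0<r = ℕP.<-≤-trans 0<dg (ℕP.≮⇒≥ λ r<dg →
        ℕP.<⇒≱ (subst (r ℕ.+ s <_) (sym k≡dg+dh) (ℕP.+-mono-<-≤ r<dg s≤dh)) k≤r+s)
      0<s : 0 < s
      0<s = ℕP.<-≤-trans 0<dh (ℕP.≮⇒≥ λ s<dh →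
        ℕP.<⇒≱ (subst (r ℕ.+ s <_) (sym k≡dg+dh) (ℕP.+-mono-≤-< r≤dg s<dh)) k≤r+s)

    -- With R, S the last indices where W, Y are prime to p, p ∤ F (R + S) forces R + S = 0,
    -- so p divides both leading coefficients W dg and Y dh.
    ¬reverseEisenstein : ¬ ReverseEisenstein k F
    ¬reverseEisenstein (_ , p∣F>0 , p²∤Fk) with last-unit degW primW | last-unit degY primY
    ... | R , p∤WR , W>R | S , p∤YS , Y>S =
      p²∤Fk (associated-p²∣ F∼WY (subst (λ j → + (p * p) ∣ℤ conv W Y j) (sym k≡dg+dh)
        (subst (+ (p * p) ∣ℤ_) (sym (conv-leading degW degY)) (p∣i∧p∣j⇒p²∣i*j (W>R dg R<dg) (Y>S dh S<dh)))))
      where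
      p∣F : ∀ {j} → 0 < j → + p ∣ℤ F j
      p∣F {j} 0<j with j ℕ.≤? k
      ... | yes j≤k = p∣F>0 j 0<j j≤k
      ... | no  j≰k = p∣beyond-degree degF (ℕP.≰⇒> j≰k)
      R+S≤0 : R ℕ.+ S ≤ 0
      R+S≤0 = ℕP.≮⇒≥ λ 0<R+S → p∤conv-last p∤WR p∤YS W>R Y>S (associated-∣ F∼WY (p∣F 0<R+S))
      R<dg : R < dg
      R<dg = ℕP.≤-<-trans (ℕP.≤-trans (ℕP.m≤m+n R S) R+S≤0) 0<dg
      S<dh : S < dh
      S<dh = ℕP.≤-<-trans (ℕP.≤-trans (ℕP.m≤n+m S R) R+S≤0) 0<dh

  PrimitivePart : (ℕ → ℤ) → Set
  PrimitivePart Z = ∃[ e ] ∃[ W ] (Primitive W × (∀ i → Z i ≡ + (p ^ e) ℤ.* W i))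

  primitivePart-*p : ∀ {Z Z′} → (∀ i → Z i ≡ Z′ i ℤ.* + p) → PrimitivePart Z′ → PrimitivePart Z
  primitivePart-*p {Z} {Z′} Z≡Z′p (e , W , primW , Z′≡p^eW) = suc e , W , primW , λ i → begin
    Z i                          ≡⟨ Z≡Z′p i ⟩
    Z′ i ℤ.* + p                 ≡⟨ cong (ℤ._* + p) (Z′≡p^eW i) ⟩
    + (p ^ e) ℤ.* W i ℤ.* + p    ≡⟨ solve 3 (λ q w p → q :* w :* p := p :* q :* w) refl (+ (p ^ e)) (W i) (+ p) ⟩
    + p ℤ.* + (p ^ e) ℤ.* W i    ≡⟨ cong (ℤ._* W i) (ℤP.pos-* p (p ^ e)) ⟨
    + (p ^ suc e) ℤ.* W i        ∎
    where
    open ≡-Reasoning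
    open +-*-Solver using (solve; _:*_; _:=_)

  -- p is divided out of all coefficients for as long as it divides them; |Z j| bounds the number of steps.
  primitive-part : ∀ {Z d j} → (∀ i → d < i → Z i ≡ + 0) → Z j ≢ + 0 → PrimitivePart Z
  primitive-part {Z} {d} {j} vanishes Zj≢0 = bounded (suc ℤ.∣ Z j ∣) {Z} vanishes Zj≢0 ℕP.≤-refl
    where
    bounded : ∀ n {Z} → (∀ i → d < i → Z i ≡ + 0) → Z j ≢ + 0 → ℤ.∣ Z j ∣ < n → PrimitivePart Z
    bounded (suc n) {Z} vanishes Zj≢0 |Zj|≤n with ℕP.anyUpTo? (λ i → ¬? (+ p ∣? Z i)) (suc d)
    ... | yes (i , _ , p∤Zi) = 0 , Z , (i , p∤Zi) , λ i → sym (ℤP.*-identityˡ (Z i))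
    ... | no  ∄i             = primitivePart-*p Z≡Z′*p (bounded n {Z′} vanishes′ Z′j≢0 |Z′j|<n)
      where
      p∣Z : ∀ i → + p ∣ℤ Z i
      p∣Z i with i ℕ.≤? d
      ... | yes i≤d = p∣-stable λ p∤Zi → ∄i (i , s≤s i≤d , p∤Zi)
      ... | no  i≰d = subst (+ p ∣ℤ_) (sym (vanishes i (ℕP.≰⇒> i≰d))) (∣+0 (+ p))

      Z′ : ℕ → ℤ
      Z′ i = _∣ℤ_.quotient (p∣Z i)

      Z≡Z′*p : ∀ i → Z i ≡ Z′ i ℤ.* + p
      Z≡Z′*p i = _∣ℤ_.equality (p∣Z i)

      vanishes′ : ∀ i → d < i → Z′ i ≡ + 0
      vanishes′ i d<i = [ (λ Z′i≡0 → Z′i≡0) , ⊥-elim ∘ +p≢0 ]′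
        (ℤP.i*j≡0⇒i≡0∨j≡0 (Z′ i) (trans (sym (Z≡Z′*p i)) (vanishes i d<i)))

      Z′j≢0 : Z′ j ≢ + 0
      Z′j≢0 Z′j≡0 = Zj≢0 (trans (Z≡Z′*p j) (cong (ℤ._* + p) Z′j≡0))

      |Z′j|<n : ℤ.∣ Z′ j ∣ < n
      |Z′j|<n = ℕP.<-≤-trans
        (subst (ℤ.∣ Z′ j ∣ <_) (sym (trans (cong ℤ.∣_∣ (Z≡Z′*p j)) (ℤP.abs-* (Z′ j) (+ p))))
          (ℕP.m<m*n _ p {{ℕ.≢-nonZero (Z′j≢0 ∘ ℤP.∣i∣≡0⇒i≡0)}} (ℕ.nonTrivial⇒n>1 p {{prime⇒nonTrivial p-prime}})))
        (ℕP.≤-pred |Zj|≤n)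

  record PrimitiveDecomposition (g : Polyℚ) : Set where
    field
      scale       : ℚ
      coeffs      : ℕ → ℤ
      degree      : ℕ
      0<degree    : 0 < degree
      hasDegree   : HasDegree coeffs degree
      isPrimitive : Primitive coeffs
      coeff≡      : ∀ i → coeff g i ≡ scale ℚ.* toℚ (coeffs i)

  primitive-decomposition : ∀ {g} → PositiveDegree g → PrimitiveDecomposition g
  primitive-decomposition {g} pos = decompose (primitive-part (HasDegree.vanishes degZ) (HasDegree.leading≢0 degZ))
    where
    open RationalDegree (rational-degree {g} pos)
    open ≡-Reasoning

    D : ℚ
    D = toℚ (+ denominatorProduct g)

    instance
      D≢0 : ℚ.NonZero D
      D≢0 = ℚ.≢-nonZero λ D≡0 → ℕ.≢-nonZero⁻¹ _ {{denominatorProduct≢0 g}} (ℤP.+-injective (toℚ-injective D≡0))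

    Z : ℕ → ℤ
    Z = clearDenominators g

    g≡Z/D : ∀ i → coeff g i ≡ ℚ.1/ D ℚ.* toℚ (Z i)
    g≡Z/D i = begin
      coeff g i                     ≡⟨ ℚP.*-identityˡ (coeff g i) ⟨
      ℚ.1ℚ ℚ.* coeff g i            ≡⟨ cong (ℚ._* coeff g i) (ℚP.*-inverseˡ D) ⟨
      ℚ.1/ D ℚ.* D ℚ.* coeff g i    ≡⟨ ℚP.*-assoc (ℚ.1/ D) D (coeff g i) ⟩
      ℚ.1/ D ℚ.* (D ℚ.* coeff g i)  ≡⟨ cong (ℚ.1/ D ℚ.*_) (clearDenominators-coeff g i) ⟩
      ℚ.1/ D ℚ.* toℚ (Z i)          ∎

    degZ : HasDegree Z degree
    degZ = record
      { leading≢0 = λ Zd≡0 → leading≢0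
          (trans (g≡Z/D degree) (trans (cong (λ z → ℚ.1/ D ℚ.* toℚ z) Zd≡0) (ℚP.*-zeroʳ (ℚ.1/ D))))
      ; vanishes  = λ i d<i → toℚ-injective
          (trans (sym (clearDenominators-coeff g i)) (trans (cong (D ℚ.*_) (vanishes i d<i)) (ℚP.*-zeroʳ D)))
      }

    decompose : PrimitivePart Z → PrimitiveDecomposition g
    decompose (e , W , primW , Z≡p^eW) = record
      { scale       = ℚ.1/ D ℚ.* toℚ (+ (p ^ e))
      ; coeffs      = W
      ; degree      = degree
      ; 0<degree    = 0<degree
      ; hasDegree   = *-degree (+p^e≢0 e) Z≡p^eW degZ
      ; isPrimitive = primW
      ; coeff≡      = λ i → begin
          coeff g i                                  ≡⟨ g≡Z/D i ⟩
          ℚ.1/ D ℚ.* toℚ (Z i)                       ≡⟨ cong (λ z → ℚ.1/ D ℚ.* toℚ z) (Z≡p^eW i) ⟩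
          ℚ.1/ D ℚ.* toℚ (+ (p ^ e) ℤ.* W i)         ≡⟨ cong (ℚ.1/ D ℚ.*_) (toℚ-* (+ (p ^ e)) (W i)) ⟩
          ℚ.1/ D ℚ.* (toℚ (+ (p ^ e)) ℚ.* toℚ (W i)) ≡⟨ ℚP.*-assoc (ℚ.1/ D) (toℚ (+ (p ^ e))) (toℚ (W i)) ⟨
          ℚ.1/ D ℚ.* toℚ (+ (p ^ e)) ℚ.* toℚ (W i)   ∎
      }

  eisenstein-cong : ∀ {k A B} → (∀ j → j ≤ k → A j ≡ B j) → Eisenstein k A → Eisenstein k B
  eisenstein-cong A≡B (p∤Ak , p∣A<k , p²∤A0) =
    subst (λ x → ¬ + p ∣ℤ x) (A≡B _ ℕP.≤-refl) p∤Ak ,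
    (λ j j<k → subst (+ p ∣ℤ_) (A≡B j (ℕP.<⇒≤ j<k)) (p∣A<k j j<k)) ,
    subst (λ x → ¬ + (p * p) ∣ℤ x) (A≡B 0 z≤n) p²∤A0

  reverseEisenstein-cong : ∀ {k A B} → (∀ j → j ≤ k → A j ≡ B j) → ReverseEisenstein k A → ReverseEisenstein k B
  reverseEisenstein-cong A≡B (p∤A0 , p∣A>0 , p²∤Ak) =
    subst (λ x → ¬ + p ∣ℤ x) (A≡B 0 z≤n) p∤A0 ,
    (λ j 0<j j≤k → subst (+ p ∣ℤ_) (A≡B j j≤k) (p∣A>0 j 0<j j≤k)) ,
    subst (λ x → ¬ + (p * p) ∣ℤ x) (A≡B _ ℕP.≤-refl) p²∤Ak

  eisenstein-irreducible : ∀ {k} A → 0 < k → Eisenstein k A ⊎ ReverseEisenstein k A →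
                           IrreducibleOverℚ (polynomial k A)
  eisenstein-irreducible {k} A 0<k eis =
    (k , 0<k , λ fk≡0 → Tk≢0 (toℚ-injective (trans (sym (coeff-polynomial k A k)) fk≡0))) , no-factorisation
    where
    T : ℕ → ℤ
    T = truncate k A

    eisT : Eisenstein k T ⊎ ReverseEisenstein k T
    eisT = Sum.map (eisenstein-cong (λ _ → sym ∘ truncate-≤)) (reverseEisenstein-cong (λ _ → sym ∘ truncate-≤)) eis

    Tk≢0 : T k ≢ + 0
    Tk≢0 = [ ∤⇒≢0 ∘ proj₁ , ∤⇒≢0 ∘ proj₂ ∘ proj₂ ]′ eisT

    degT : HasDegree T k
    degT = record { leading≢0 = Tk≢0 ; vanishes = λ _ → truncate-> }

    primT : Primitive T
    primT = [ (λ e → k , proj₁ e) , (λ e → 0 , proj₁ e) ]′ eisT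

    no-factorisation : ∀ g h → IsProduct (polynomial k A) g h → PositiveDegree g → PositiveDegree h → ⊥
    no-factorisation g h f≡gh pos-g pos-h = [ ¬eisenstein , ¬reverseEisenstein ]′ eisT
      where
      module G = PrimitiveDecomposition (primitive-decomposition {g} pos-g)
      module H = PrimitiveDecomposition (primitive-decomposition {h} pos-h)

      T∼GH : Associated T (conv G.coeffs H.coeffs)
      T∼GH = associated (G.scale ℚ.* H.scale)
        (λ m → trans (sym (coeff-polynomial k A m))
                     (scaled-product (polynomial k A) g h {G.scale} {H.scale} {G.coeffs} {H.coeffs}
                                     f≡gh G.coeff≡ H.coeff≡ m))
        primT (conv-primitive G.isPrimitive H.isPrimitive)

      open NonFactorisation T∼GH degT G.hasDegree H.hasDegree G.0<degree H.0<degree G.isPrimitive H.isPrimitive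

-- Binomial coefficients

C*!≡P′ : ∀ {n k} → k ≤ n → (n C k) * k ℕ.! ≡ n P′ k
C*!≡P′ {n} {k} k≤n = begin
  (n C k) * k ℕ.!               ≡⟨ cong (_* k ℕ.!) (nCk≡nPk/k! k≤n) ⟩
  ((n P k) ℕ./ k ℕ.!) * k ℕ.!   ≡⟨ cong (λ x → (x ℕ./ k ℕ.!) * k ℕ.!) P≡P′ ⟩
  ((n P′ k) ℕ./ k ℕ.!) * k ℕ.!  ≡⟨ m/n*n≡m (k!∣nP′k k≤n) ⟩
  n P′ k                        ∎
  where
  open ≡-Reasoning
  instance _ = k ℕP.!≢0
  P≡P′ : n P k ≡ n P′ k
  P≡P′ = trans (nPk≡n!/[n∸k]! k≤n) (sym (nP′k≡n!/[n∸k]! k≤n))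

∤P′⇒∤C : ∀ {d m r} → r ≤ m → ¬ d ∣ m P′ r → ¬ d ∣ m C r
∤P′⇒∤C {r = r} r≤m d∤P′ d∣C = d∤P′ (subst (_ ∣_) (C*!≡P′ r≤m) (ℕD.∣m⇒∣m*n (r ℕ.!) d∣C))

<⇒≤∸1 : ∀ {m n} → m < n → m ≤ n ∸ 1
<⇒≤∸1 {m} {n} m<n = ℕP.m+n≤o⇒m≤o∸n m (subst (_≤ n) (ℕP.+-comm 1 m) m<n)

∸-split : ∀ {m i j} → i ≤ j → j ≤ m → m ∸ i ≡ (m ∸ j) ℕ.+ (j ∸ i)
∸-split {m} {i} {j} i≤j j≤m = trans (cong (_∸ i) (sym (ℕP.m∸n+n≡m j≤m))) (ℕP.+-∸-assoc (m ∸ j) i≤j)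

∣sgn∣≡1 : ∀ e → ℤ.∣ sgn e ∣ ≡ 1
∣sgn∣≡1 zero    = refl
∣sgn∣≡1 (suc e) = trans (ℤP.abs-* (ℤ.- + 1) (sgn e)) (trans (ℕP.*-identityˡ _) (∣sgn∣≡1 e))

∣cCoeff∣ : ∀ n k j → ℤ.∣ cCoeff n k j ∣ ≡ (n C j) * ((n ∸ j ∸ 1) C (k ∸ j))
∣cCoeff∣ n k j = begin
  ℤ.∣ + a ℤ.* + b ℤ.* sgn (k ∸ j) ∣           ≡⟨ ℤP.abs-* (+ a ℤ.* + b) (sgn (k ∸ j)) ⟩
  ℤ.∣ + a ℤ.* + b ∣ * ℤ.∣ sgn (k ∸ j) ∣       ≡⟨ cong₂ _*_ (ℤP.abs-* (+ a) (+ b)) (∣sgn∣≡1 (k ∸ j)) ⟩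
  a * b * 1                                   ≡⟨ ℕP.*-identityʳ (a * b) ⟩
  a * b                                       ∎
  where
  open ≡-Reasoning
  a = n C j
  b = (n ∸ j ∸ 1) C (k ∸ j)

module _ {p : ℕ} (p-prime : Prime p) where

  p∤! : ∀ {r} → r < p → ¬ p ∣ r ℕ.!
  p∤! {zero}  _   p∣1 = ¬prime[1] (subst Prime (ℕD.∣1⇒≡1 p∣1) p-prime)
  p∤! {suc r} r<p p∣r! with euclidsLemma (suc r) (r ℕ.!) p-prime p∣r!
  ... | inj₁ p∣1+r = ℕD.>⇒∤ r<p p∣1+r
  ... | inj₂ p∣r!  = p∤! (ℕP.<-trans (ℕP.n<1+n r) r<p) p∣r!

  p∣P′⇒p∣C : ∀ {m r} → r ≤ m → r < p → p ∣ m P′ r → p ∣ m C r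
  p∣P′⇒p∣C {m} {r} r≤m r<p p∣P′ with euclidsLemma (m C r) (r ℕ.!) p-prime (subst (p ∣_) (sym (C*!≡P′ r≤m)) p∣P′)
  ... | inj₁ p∣C  = p∣C
  ... | inj₂ p∣r! = ⊥-elim (p∤! r<p p∣r!)

  p∤P′ : ∀ {m r} → (∀ i → i < r → ¬ p ∣ m ∸ i) → ¬ p ∣ m P′ r
  p∤P′ {r = zero}      _     p∣1  = ¬prime[1] (subst Prime (ℕD.∣1⇒≡1 p∣1) p-prime)
  p∤P′ {m} {r = suc r} units p∣P′ with euclidsLemma (m ∸ r) (m P′ r) p-prime p∣P′
  ... | inj₁ p∣m∸r = units r ℕP.≤-refl p∣m∸r
  ... | inj₂ p∣P′r = p∤P′ (λ i i<r → units i (ℕP.m≤n⇒m≤1+n i<r)) p∣P′r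

  p²∤P′ : ∀ {m r i₀} → i₀ < r → ¬ p * p ∣ m ∸ i₀ → (∀ i → i < r → i ≢ i₀ → ¬ p ∣ m ∸ i) → ¬ p * p ∣ m P′ r
  p²∤P′ {m} {suc r} (s≤s i₀≤r) p²∤m∸i₀ units p²∣P′ with ℕP.m≤n⇒m<n∨m≡n i₀≤r
  ... | inj₂ refl = p²∤m∸i₀ (p²∣m*n∧p∤n⇒p²∣m p-prime
    (p∤P′ λ i i<r → units i (ℕP.m≤n⇒m≤1+n i<r) (ℕP.<⇒≢ i<r)) p²∣P′)
  ... | inj₁ i₀<r = p²∤P′ i₀<r p²∤m∸i₀ (λ i i<r → units i (ℕP.m≤n⇒m≤1+n i<r))
    (p²∣m*n∧p∤n⇒p²∣m p-prime (units r ℕP.≤-refl (ℕP.<⇒≢ i₀<r ∘ sym))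
      (subst (p * p ∣_) (ℕP.*-comm (m ∸ r) (m P′ r)) p²∣P′))

  p∣m∸i⇒p∤m∸j : ∀ {m i j} → i < j → j ≤ m → j < p → p ∣ m ∸ i → ¬ p ∣ m ∸ j
  p∣m∸i⇒p∤m∸j {m} {i} {j} i<j j≤m j<p p∣m∸i p∣m∸j =
    ℕD.>⇒∤ {{ℕ.>-nonZero (ℕP.m<n⇒0<n∸m i<j)}} (ℕP.≤-<-trans (ℕP.m∸n≤m j i) j<p)
      (ℕD.∣m+n∣m⇒∣n (subst (p ∣_) (∸-split (ℕP.<⇒≤ i<j) j≤m) p∣m∸i) p∣m∸j)

  -- Each fact below reads the divisibility of C(m, r) off the factors m, m ∸ 1, …, m ∸ (r ∸ 1)
  -- of m P′ r = C(m, r) · r!, of which at most one is divisible by p since r ≤ k < p.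
  module _ {n k : ℕ} (0<k : 0 < k) (k<n : k < n) (k<p : k < p) where

    private
      k≤n : k ≤ n
      k≤n = ℕP.<⇒≤ k<n

      k≤n∸1 : k ≤ n ∸ 1
      k≤n∸1 = <⇒≤∸1 k<n

    p∣C[n∸j∸1,k∸j] : p ∣ n ∸ k → ∀ {j} → j < k → p ∣ (n ∸ j ∸ 1) C (k ∸ j)
    p∣C[n∸j∸1,k∸j] p∣n∸k {j} j<k = subst (p ∣_) (sym (cong₂ _C_ n∸j∸1≡m k∸j≡1+r))
      (p∣P′⇒p∣C 1+r≤m 1+r<p (ℕD.∣m⇒∣m*n (m P′ r) (subst (p ∣_) (sym m∸r≡n∸k) p∣n∸k)))
      where
      r = k ∸ suc j
      m = n ∸ suc j
      n∸j∸1≡m : n ∸ j ∸ 1 ≡ m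
      n∸j∸1≡m = trans (ℕP.∸-+-assoc n j 1) (cong (n ∸_) (ℕP.+-comm j 1))
      k∸j≡1+r : k ∸ j ≡ suc r
      k∸j≡1+r = ℕP.+-∸-assoc 1 j<k
      1+r<p : suc r < p
      1+r<p = ℕP.≤-<-trans (subst (_≤ k) k∸j≡1+r (ℕP.m∸n≤m k j)) k<p
      m≡n∸k+r : m ≡ (n ∸ k) ℕ.+ r
      m≡n∸k+r = ∸-split j<k k≤n
      m∸r≡n∸k : m ∸ r ≡ n ∸ k
      m∸r≡n∸k = trans (cong (_∸ r) m≡n∸k+r) (ℕP.m+n∸n≡m (n ∸ k) r)
      1+r≤m : suc r ≤ m
      1+r≤m = subst (suc r ≤_) (sym m≡n∸k+r) (ℕP.+-monoˡ-≤ r (ℕP.m<n⇒0<n∸m k<n))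

    p∤C[n,k] : p ∣ n ∸ k → ¬ p ∣ n C k
    p∤C[n,k] p∣n∸k = ∤P′⇒∤C k≤n (p∤P′ λ i i<k p∣n∸i → p∣m∸i⇒p∤m∸j i<k k≤n k<p p∣n∸i p∣n∸k)

    p²∤C[n∸1,k] : p ∣ n ∸ k → ¬ p * p ∣ n ∸ k → ¬ p * p ∣ (n ∸ 1) C k
    p²∤C[n∸1,k] p∣n∸k p²∤n∸k =
      ∤P′⇒∤C k≤n∸1 (p²∤P′ (ℕP.∸-monoʳ-< (s≤s z≤n) 0<k) (p²∤n∸k ∘ subst (p * p ∣_) [n∸1]∸[k∸1]≡n∸k) units)
      where
      [n∸1]∸[k∸1]≡n∸k : (n ∸ 1) ∸ (k ∸ 1) ≡ n ∸ k
      [n∸1]∸[k∸1]≡n∸k = trans (ℕP.∸-+-assoc n 1 (k ∸ 1)) (cong (n ∸_) (ℕP.m+[n∸m]≡n 0<k))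
      units : ∀ i → i < k → i ≢ k ∸ 1 → ¬ p ∣ (n ∸ 1) ∸ i
      units i i<k i≢k∸1 p∣ = p∣m∸i⇒p∤m∸j (ℕP.≤∧≢⇒< (<⇒≤∸1 i<k) i≢k∸1) (ℕP.∸-monoˡ-≤ 1 k≤n)
        (ℕP.≤-<-trans (ℕP.m∸n≤m k 1) k<p) p∣ (subst (p ∣_) (sym [n∸1]∸[k∸1]≡n∸k) p∣n∸k)

    p∣C[n,j] : p ∣ n → ∀ {j} → 0 < j → j ≤ k → p ∣ n C j
    p∣C[n,j] p∣n {j} 0<j j≤k = p∣P′⇒p∣C (ℕP.≤-trans j≤k k≤n) (ℕP.≤-<-trans j≤k k<p)
      (subst (p ∣_) (sym (nP′k≡n[n∸1P′k∸1] n j {{ℕ.>-nonZero (ℕP.<-trans 0<k k<n)}} {{ℕ.>-nonZero 0<j}}))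
        (ℕD.∣m⇒∣m*n _ p∣n))

    p∤C[n∸1,k] : p ∣ n → ¬ p ∣ (n ∸ 1) C k
    p∤C[n∸1,k] p∣n = ∤P′⇒∤C k≤n∸1 (p∤P′ λ i i<k p∣[n∸1]∸i →
      p∣m∸i⇒p∤m∸j (s≤s z≤n) (ℕP.≤-trans i<k k≤n) (ℕP.≤-<-trans i<k k<p) p∣n
        (subst (p ∣_) (ℕP.∸-+-assoc n 1 i) p∣[n∸1]∸i))

    p²∤C[n,k] : p ∣ n → ¬ p * p ∣ n → ¬ p * p ∣ n C k
    p²∤C[n,k] p∣n p²∤n = ∤P′⇒∤C k≤n (p²∤P′ 0<k p²∤n λ i i<k i≢0 p∣n∸i →
      p∣m∸i⇒p∤m∸j (ℕP.n≢0⇒n>0 i≢0) (ℕP.<⇒≤ (ℕP.<-≤-trans i<k k≤n)) (ℕP.<-trans i<k k<p) p∣n p∣n∸i)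

    private
      N : ℕ → ℕ
      N j = (n C j) * ((n ∸ j ∸ 1) C (k ∸ j))

      N0≡ : N 0 ≡ (n ∸ 1) C k
      N0≡ = ℕP.*-identityˡ _

      Nk≡ : N k ≡ n C k
      Nk≡ = trans (cong (λ i → (n C k) * ((n ∸ k ∸ 1) C i)) (ℕP.n∸n≡0 k)) (ℕP.*-identityʳ _)

      p∣A : ∀ (a : ℕ → ℤ) j → p ∣ N j → + p ∣ℤ a j ℤ.* cCoeff n k j
      p∣A a j p∣N = ∣n⇒∣m*n (a j) (∣ᵤ⇒∣ (subst (p ∣_) (sym (∣cCoeff∣ n k j)) p∣N))

      p∤A : ∀ (a : ℕ → ℤ) j → ¬ + p ∣ℤ a j → ¬ p ∣ N j → ¬ + p ∣ℤ a j ℤ.* cCoeff n k j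
      p∤A a j p∤aj p∤N = p∤i∧p∤j⇒p∤i*j p-prime p∤aj (p∤N ∘ subst (p ∣_) (∣cCoeff∣ n k j) ∘ ∣⇒∣ᵤ)

      p²∤A : ∀ (a : ℕ → ℤ) j → ¬ + p ∣ℤ a j → ¬ p * p ∣ N j → ¬ + (p * p) ∣ℤ a j ℤ.* cCoeff n k j
      p²∤A a j p∤aj p²∤N = p²∤N ∘ subst (p * p ∣_) (∣cCoeff∣ n k j) ∘ ∣⇒∣ᵤ
        ∘ p²∣i*j∧p∤j⇒p²∣i p-prime {cCoeff n k j} p∤aj ∘ subst (+ (p * p) ∣ℤ_) (ℤP.*-comm (a j) (cCoeff n k j))

    binomial-eisenstein : ∀ a → (∀ j → j ≤ k → ¬ + p ∣ℤ a j) → p ∣ n * (n ∸ k) → ¬ p * p ∣ n * (n ∸ k) →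
      Eisenstein p-prime k (λ j → a j ℤ.* cCoeff n k j) ⊎ ReverseEisenstein p-prime k (λ j → a j ℤ.* cCoeff n k j)
    binomial-eisenstein a p∤a p∣n[n∸k] p²∤n[n∸k] with euclidsLemma n (n ∸ k) p-prime p∣n[n∸k]
    ... | inj₂ p∣n∸k = inj₁
      ( p∤A a k (p∤a k ℕP.≤-refl) (p∤C[n,k] p∣n∸k ∘ subst (p ∣_) Nk≡)
      , (λ j j<k → p∣A a j (ℕD.∣n⇒∣m*n (n C j) (p∣C[n∸j∸1,k∸j] p∣n∸k j<k)))
      , p²∤A a 0 (p∤a 0 z≤n) (p²∤C[n∸1,k] p∣n∸k (p²∤n[n∸k] ∘ ℕD.∣n⇒∣m*n n) ∘ subst (p * p ∣_) N0≡))
    ... | inj₁ p∣n = inj₂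
      ( p∤A a 0 (p∤a 0 z≤n) (p∤C[n∸1,k] p∣n ∘ subst (p ∣_) N0≡)
      , (λ j 0<j j≤k → p∣A a j (ℕD.∣m⇒∣m*n _ (p∣C[n,j] p∣n 0<j j≤k)))
      , p²∤A a k (p∤a k ℕP.≤-refl) (p²∤C[n,k] p∣n (p²∤n[n∸k] ∘ ℕD.∣m⇒∣m*n (n ∸ k)) ∘ subst (p * p ∣_) Nk≡))

theorem2 : (n k : ℕ) → 1 ≤ k → k ≤ n ∸ 1 →
    (∃[ p ] (Prime p × k < p × p ∣ n * (n ∸ k) × ¬ (p ^ 2 ∣ n * (n ∸ k)))) →
    (a : ℕ → ℤ) → (∀ j → j ≤ k → AllPrimeFactorsLe k (a j)) →
    IrreducibleOverℚ (F n k a)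
theorem2 n k 1≤k k≤n∸1 (p , p-prime , k<p , p∣n[n∸k] , p²∤n[n∸k]) a a-smooth =
  eisenstein-irreducible p-prime (λ j → a j ℤ.* cCoeff n k j) 1≤k
    (binomial-eisenstein p-prime 1≤k k<n k<p a p∤a p∣n[n∸k] (p²∤n[n∸k] ∘ subst (_∣ n * (n ∸ k)) p*p≡p^2))
  where
  k<n : k < n
  k<n = subst (_≤ n) (ℕP.+-comm k 1) (ℕP.m≤o∸n⇒m+n≤o k (ℕP.≤-trans 1≤k (ℕP.≤-trans k≤n∸1 (ℕP.m∸n≤m n 1))) k≤n∸1)

  p∤a : ∀ j → j ≤ k → ¬ + p ∣ℤ a j
  p∤a j j≤k p∣aj = ℕP.<⇒≱ k<p (proj₂ (a-smooth j j≤k) p p-prime (∣⇒∣ᵤ p∣aj))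

  p*p≡p^2 : p * p ≡ p ^ 2
  p*p≡p^2 = cong (p *_) (sym (ℕP.*-identityʳ p))
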